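{- Let $H,G_1,G_2,G_3,G_4$ be the five graphs of $\mathcal{LBM}(3,6)$, where: - $H$ is the Heawood graph, with girth vector $6^{14}$; - $G_1$ has girth vector $6^6,4^8$; - $G_2$ has girth vector $6^4,4^{10}$; - $G_3$ and $G_4$ are the two remaining graphs, each with girth vector $6^2,4^{12}$. Then $H\prec G_1\prec G_2\prec G_3\approx G_4$.
   Context: $\mathcal{LBM}(\Delta,g)$ denotes the set, up to isomorphism, of local bipartite Moore graphs of degree $\Delta$ and girth $g$. These are connected $\Delta$-regular bipartite graphs of order $M^b_{\Delta,g}=2\frac{(\Delta-1)^{g/2}-1}{\Delta-2}$ having at least one edge $uv$ such that the breadth-first spanning tree rooted at $uv$ is a bipartite Moore tree of depth $g/2$. This means a tree in which every vertex at distance less than $g/2-1$ from the root edge has degree $\Delta$, and whose leaves are exactly the vertices at distance $g/2-1$ from the root edge. The set $\mathcal{LBM}(3,6)$ consists of exactly five graphs on $14$ vertices. The local girth $g(v)$ of a vertex $v$ is the length of a shortest cycle through $v$. The girth vector $\mathbf g(G)$ is the vector of local girths of all vertices. The notation $g_1^{n_1},\dots,g_k^{n_k}$ means that $n_i$ vertices have local girth $g_i$. Let $\mathbf g_{\Delta,g}$ be the all-$g$ vector of length $M^b_{\Delta,g}$. For $p\ge1$, define $\tilde N_p(G)=\|\mathbf g(G)-\mathbf g_{\Delta,g}\|_p$. Two graphs $G,G'\in\mathcal{LBM}(\Delta,g)$ are girth-equivalent, written $G\approx G'$, if they have the same girth vector, taken up to reordering of the vertices. $G\prec G'$ means there is a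 positive integer $l$ with $\tilde N_p(G)=\tilde N_p(G')$ for $p=1,\dots,l-1$ and $\tilde N_l(G)<\tilde N_l(G')$. -}

module Defs where

open import Data.Bool using (Bool; true; false)
open import Data.Nat using (ℕ; zero; suc; _+_; _*_; _∸_; _^_; _≤_; _<_; ∣_-_∣)
open import Data.Nat.DivMod using (_/_)
open import Data.Fin using (Fin)
open import Data.List using (List; []; _∷_; length; map; filterᵇ; allFin)
open import Data.Nat.ListAction using (sum)
open import Data.List.Relation.Unary.Linked using (Linked)
open import Data.List.Relation.Unary.Unique.Propositional using (Unique)
open import Data.List.Relation.Binary.Permutation.Propositional using (_↭_)
open import Data.Vec.Functional using (toList)
open import Data.Product using (Σ; _×_; ∃)
open import Data.Sum using (_⊎_)
open import Relation.Binary.PropositionalEquality using (_≡_; _≢_)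
open import Relation.Binary.Construct.Closure.ReflexiveTransitive using (Star)
open import Relation.Nullary using (¬_)

record Graph (n : ℕ) : Set where
  field
    adj   : Fin n → Fin n → Bool
    sym   : ∀ x y → adj x y ≡ adj y x
    loopless : ∀ x → adj x x ≡ false
open Graph public

Adj : {n : ℕ} → Graph n → Fin n → Fin n → Set
Adj G x y = adj G x y ≡ true

degree : {n : ℕ} → Graph n → Fin n → ℕ
degree {n} G x = length (filterᵇ (adj G x) (allFin n))

Regular : {n : ℕ} → ℕ → Graph n → Set
Regular Δ G = ∀ x → degree G x ≡ Δ

Connected : {n : ℕ} → Graph n → Set
Connected G = ∀ x y → Star (Adj G) x y

Bipartite : {n : ℕ} → Graph n → Set
Bipartite {n} G = Σ (Fin n → Bool) λ col → ∀ x y → Adj G x y → col x ≢ col y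

data Within {n : ℕ} (G : Graph n) : ℕ → Fin n → Fin n → Set where
  here  : ∀ {k x} → Within G k x x
  there : ∀ {k x y z} → Adj G x z → Within G k z y → Within G (suc k) x y

-- Order of a bipartite Moore graph: n = 2((Δ-1)^(g/2) - 1)/(Δ-2),
-- written multiplicatively to avoid division.
IsBipartiteMooreOrder : ℕ → ℕ → ℕ → Set
IsBipartiteMooreOrder Δ g n = n * (Δ ∸ 2) ≡ 2 * ((Δ ∸ 1) ^ (g / 2) ∸ 1)

-- The BFS spanning tree rooted at the edge uv is a bipartite Moore tree of
-- depth g/2: every vertex lies within distance g/2 - 1 of the root edge
-- (given the Moore order and Δ-regularity this forces every level d to be
-- full, i.e. every inner vertex has degree Δ in the tree).
MooreTreeAt : {n : ℕ} → ℕ → Graph n → Fin n → Fin n → Set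
MooreTreeAt g G u v = ∀ w → Within G (g / 2 ∸ 1) u w ⊎ Within G (g / 2 ∸ 1) v w

LBM : {n : ℕ} → ℕ → ℕ → Graph n → Set
LBM {n} Δ g G =
  IsBipartiteMooreOrder Δ g n × Connected G × Regular Δ G × Bipartite G ×
  Σ (Fin n) λ u → Σ (Fin n) λ v → Adj G u v × MooreTreeAt g G u v

lastOf : {A : Set} → A → List A → A
lastOf x []       = x
lastOf x (y ∷ ys) = lastOf y ys

CycleThrough : {n : ℕ} → Graph n → Fin n → ℕ → Set
CycleThrough {n} G v k =
  Σ (List (Fin n)) λ xs →
    length (v ∷ xs) ≡ k × 3 ≤ k × Unique (v ∷ xs) ×
    Linked (Adj G) (v ∷ xs) × Adj G (lastOf v xs) v

IsLocalGirth : {n : ℕ} → Graph n → Fin n → ℕ → Set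
IsLocalGirth G v k = CycleThrough G v k × (∀ m → m < k → ¬ CycleThrough G v m)

IsGirthVector : {n : ℕ} → Graph n → (Fin n → ℕ) → Set
IsGirthVector G gv = ∀ v → IsLocalGirth G v (gv v)

HasGirthVector : {n : ℕ} → Graph n → List ℕ → Set
HasGirthVector G spec = Σ _ λ gv → IsGirthVector G gv × toList gv ↭ spec

-- p-th power of Ñ_p: Σ_v |g(v) - g|^p  (Ñ_p itself is its p-th root; since
-- t ↦ t^(1/p) is strictly increasing, comparisons are unchanged).
NpPow : {n : ℕ} → ℕ → ℕ → (Fin n → ℕ) → ℕ
NpPow g p gv = sum (map (λ x → ∣ x - g ∣ ^ p) (toList gv))

Prec : {n : ℕ} → ℕ → (Fin n → ℕ) → (Fin n → ℕ) → Set
Prec g x y = Σ ℕ λ l → 1 ≤ l ×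
  (∀ p → 1 ≤ p → p < l → NpPow g p x ≡ NpPow g p y) × NpPow g l x < NpPow g l y

PrecG : {n : ℕ} → ℕ → Graph n → Graph n → Set
PrecG g G G' = ∀ x y → IsGirthVector G x → IsGirthVector G' y → Prec g x y

GirthEquiv : {n : ℕ} → Graph n → Graph n → Set
GirthEquiv G G' = ∀ x y → IsGirthVector G x → IsGirthVector G' y → toList x ↭ toList y

-- Local girths are unique (a shortest cycle length is determined), so the
-- girth vector of each graph is a permutation of its prescribed multiset and
-- every Ñ_p depends only on that multiset.  Already Ñ_1 separates the first
-- three comparisons: it equals 0, 8·2 = 16, 10·2 = 20 and 12·2 = 24 for
-- H, G₁, G₂ and G₃ respectively, while G₃ and G₄ share their multiset.
module Submission where

open import Defs
open import Data.Nat using (ℕ; _<_; s≤s; z≤n; ∣_-_∣; _^_)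
open import Data.Nat.Properties using (<-cmp; _<?_)
open import Data.Nat.ListAction using (sum)
open import Data.Nat.ListAction.Properties using (sum-↭)
open import Data.Fin using (Fin)
open import Data.List using (List; map; replicate; _++_)
open import Data.List.Properties using (tabulate-cong)
open import Data.List.Relation.Binary.Permutation.Propositional using (_↭_; ↭-sym; ↭-trans; ↭-reflexive)
open import Data.List.Relation.Binary.Permutation.Propositional.Properties using (map⁺)
open import Data.Vec.Functional using (toList)
open import Data.Product using (_×_; _,_)
open import Data.Empty using (⊥-elim)
open import Relation.Binary using (tri<; tri≈; tri>)
open import Relation.Binary.PropositionalEquality using (_≡_; subst₂)
import Relation.Binary.PropositionalEquality as ≡
open import Relation.Nullary.Decidable using (from-yes)

localGirth-unique : ∀ {n} (G : Graph n) {v k k′} →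
  IsLocalGirth G v k → IsLocalGirth G v k′ → k ≡ k′
localGirth-unique G {k = k} {k′} (c , min) (c′ , min′) with <-cmp k k′
... | tri< k<k′ _ _ = ⊥-elim (min′ k k<k′ c)
... | tri≈ _ k≡k′ _ = k≡k′
... | tri> _ _ k′<k = ⊥-elim (min k′ k′<k c′)

girthVector-↭ : ∀ {n} (G : Graph n) {spec x} →
  HasGirthVector G spec → IsGirthVector G x → toList x ↭ spec
girthVector-↭ G (gv , isGv , gv↭spec) isX =
  ↭-trans (↭-reflexive (tabulate-cong λ v → localGirth-unique G (isX v) (isGv v))) gv↭spec

deviationSum : ℕ → ℕ → List ℕ → ℕ
deviationSum g p spec = sum (map (λ x → ∣ x - g ∣ ^ p) spec)

NpPow-↭ : ∀ {n} g p {x : Fin n → ℕ} {spec} →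
  toList x ↭ spec → NpPow g p x ≡ deviationSum g p spec
NpPow-↭ g p x↭spec = sum-↭ (map⁺ _ x↭spec)

NpPow-from-spec : ∀ {n} g p (G : Graph n) {spec x} →
  HasGirthVector G spec → IsGirthVector G x → NpPow g p x ≡ deviationSum g p spec
NpPow-from-spec g p G hG isX = NpPow-↭ g p (girthVector-↭ G hG isX)

prec-at-1 : ∀ {n} g (x y : Fin n → ℕ) → NpPow g 1 x < NpPow g 1 y → Prec g x y
prec-at-1 g x y lt = 1 , s≤s z≤n , (λ { _ (s≤s _) (s≤s ()) }) , lt

precG-from-spec : ∀ {n} g (G G′ : Graph n) {spec spec′} →
  HasGirthVector G spec → HasGirthVector G′ spec′ →
  deviationSum g 1 spec < deviationSum g 1 spec′ → PrecG g G G′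
precG-from-spec g G G′ hG hG′ lt x y isX isY =
  prec-at-1 g x y
    (subst₂ _<_ (≡.sym (NpPow-from-spec g 1 G hG isX)) (≡.sym (NpPow-from-spec g 1 G′ hG′ isY)) lt)

girthEquiv-from-spec : ∀ {n} (G G′ : Graph n) {spec} →
  HasGirthVector G spec → HasGirthVector G′ spec → GirthEquiv G G′
girthEquiv-from-spec G G′ hG hG′ x y isX isY =
  ↭-trans (girthVector-↭ G hG isX) (↭-sym (girthVector-↭ G′ hG′ isY))

corollary1 : (H G₁ G₂ G₃ G₄ : Graph 14) →
    LBM 3 6 H → LBM 3 6 G₁ → LBM 3 6 G₂ → LBM 3 6 G₃ → LBM 3 6 G₄ →
    HasGirthVector H (replicate 14 6) →
    HasGirthVector G₁ (replicate 6 6 ++ replicate 8 4) →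
    HasGirthVector G₂ (replicate 4 6 ++ replicate 10 4) →
    HasGirthVector G₃ (replicate 2 6 ++ replicate 12 4) →
    HasGirthVector G₄ (replicate 2 6 ++ replicate 12 4) →
    PrecG 6 H G₁ × PrecG 6 G₁ G₂ × PrecG 6 G₂ G₃ × GirthEquiv G₃ G₄
corollary1 H G₁ G₂ G₃ G₄ _ _ _ _ _ hH h₁ h₂ h₃ h₄ =
  precG-from-spec 6 H G₁ hH h₁ (from-yes (0 <? 16)) ,
  precG-from-spec 6 G₁ G₂ h₁ h₂ (from-yes (16 <? 20)) ,
  precG-from-spec 6 G₂ G₃ h₂ h₃ (from-yes (20 <? 24)) ,
  girthEquiv-from-spec G₃ G₄ h₃ h₄
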